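{- Let $D$ be a finite arc-colored digraph (an $m$-colored digraph) in which every chromatic class is transitive, let $u,v,w$ be pairwise distinct vertices of $D$, let $P_1$ be a directed $uv$-path in $D$ and $P_2$ a directed $vw$-path in $D$. Then: (1) if $P_1$ and $P_2$ are properly colored paths, then there exists a properly colored $uw$-path in $D$; (2) if $\mathscr{C}_C(D)$ has no directed cycles of length at least two, then every properly colored path of $D$ is a rainbow path.
   Context: A chromatic class is the set of arcs of one color; it is transitive if the subdigraph formed by these arcs is transitive (arcs $(a,b),(b,c)$ of that color imply $(a,c)$ is an arc of $D$ of that color — equivalently, $(a,c)$ belongs to the class). A path is properly colored if consecutive arcs have different colors, and rainbow if all its arcs have distinct colors. The color-class digraph $\mathscr{C}_C(D)$ has as vertices the colors appearing on arcs of $D$, with $(i,j)$ an arc (loops allowed) iff there are arcs $(x,y),(y,z)$ in $D$ colored $i$ and $j$ respectively. -}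

module Defs where

open import Data.Nat using (ℕ; _≤_)
open import Data.Fin using (Fin)
open import Data.Maybe using (Maybe; just; nothing)
open import Data.List using (List; []; _∷_; _++_; [_]; length)
open import Data.List.Relation.Unary.Linked using (Linked)
open import Data.List.Relation.Unary.Unique.Propositional using (Unique)
open import Data.Product using (Σ; ∃; ∃-syntax; _×_)
open import Relation.Binary.PropositionalEquality using (_≡_; _≢_)
open import Relation.Nullary using (¬_)

-- An m-colored digraph on the vertex set Fin n (finite, loopless, no parallel arcs):
-- D x y ≡ just c  means  (x , y) is an arc of D and it has color c;
-- D x y ≡ nothing means  (x , y) is not an arc.
record ColoredDigraph (n m : ℕ) : Set where
  field
    arcColor : Fin n → Fin n → Maybe (Fin m)
    loopless : ∀ x → arcColor x x ≡ nothing
open ColoredDigraph public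

module _ {n m : ℕ} (D : ColoredDigraph n m) where

  ArcOf : Fin n → Fin n → Fin m → Set
  ArcOf x y c = arcColor D x y ≡ just c

  -- every chromatic class is transitive
  -- (for distinct a , c, as D is loopless)
  AllClassesTransitive : Set
  AllClassesTransitive =
    ∀ (i : Fin m) (a b c : Fin n) → a ≢ c → ArcOf a b i → ArcOf b c i → ArcOf a c i

  data Walk : Fin n → Fin n → Set where
    []  : ∀ {x} → Walk x x
    arc : ∀ {x y z} (c : Fin m) → ArcOf x y c → Walk y z → Walk x z

  vertices : ∀ {x y} → Walk x y → List (Fin n)
  vertices {x} [] = x ∷ []
  vertices {x} (arc c _ p) = x ∷ vertices p

  colors : ∀ {x y} → Walk x y → List (Fin m)
  colors [] = []
  colors (arc c _ p) = c ∷ colors p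

  IsPath : ∀ {x y} → Walk x y → Set
  IsPath p = Unique (vertices p)

  ProperlyColored : ∀ {x y} → Walk x y → Set
  ProperlyColored p = Linked _≢_ (colors p)

  Rainbow : ∀ {x y} → Walk x y → Set
  Rainbow p = Unique (colors p)

  -- arcs of the color-class digraph C_C(D) (loops allowed)
  CCArc : Fin m → Fin m → Set
  CCArc i j = ∃[ x ] ∃[ y ] ∃[ z ] (ArcOf x y i × ArcOf y z j)

  -- a directed cycle of length at least two in C_C(D):
  -- distinct colors i , j₁ , … , jₖ (k ≥ 1) with arcs i → j₁ → … → jₖ → i
  CCCycle≥2 : Set
  CCCycle≥2 = Σ (Fin m) λ i → Σ (List (Fin m)) λ rest →
      (1 ≤ length rest)
    × Unique (i ∷ rest)
    × Linked CCArc (i ∷ rest ++ [ i ])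

-- (1) holds for every uw-walk, not only for the concatenation of two properly
-- colored paths: a shortest uw-walk is a properly colored path.  A repeated
-- vertex can be cut out, and two consecutive arcs a → b → c of the same color
-- can be replaced by the single arc a → c, which exists by transitivity of
-- that color class (a ≢ c because the rest of the walk is a path).
-- (2) The colors along any walk form a walk in C_C(D).  If a properly colored
-- path repeats a color, the segment between two occurrences of that color is
-- a closed walk in C_C(D) of length at least two (consecutive colors differ);
-- for the last color that reappears, it is a cycle.  Neither part needs the
-- given walks to be paths.
module Submission where

open import Defs
open import Data.Nat using (ℕ; suc; _≤_; _<_; z≤n; s≤s)
open import Data.Nat.Properties using (≤-refl; ≤-trans; n≤1+n; n<1+n)
open import Data.Nat.Induction using (<-wellFounded)
open import Induction.WellFounded using (Acc; acc)
open import Data.Fin using (Fin)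
open import Data.Fin.Properties using (_≟_)
open import Data.Product using (Σ; _×_; _,_)
open import Data.Sum using (_⊎_; inj₁; inj₂)
open import Data.Empty using (⊥-elim)
open import Data.List using (List; []; _∷_; _++_; [_]; length)
open import Data.List.Relation.Unary.Linked as Linked using (Linked; []; [-]; _∷_)
open import Data.List.Relation.Unary.All as All using (All; []; _∷_)
open import Data.List.Relation.Unary.All.Properties using (¬Any⇒All¬; ++⁻ˡ; ++⁻ʳ)
open import Data.List.Relation.Unary.Any using (here; there)
open import Data.List.Relation.Unary.AllPairs using ([]; _∷_)
open import Data.List.Relation.Unary.Unique.Propositional using (Unique)
open import Data.List.Membership.Propositional using (_∈_)
open import Data.List.Membership.Propositional.Properties using (∈-∃++)
open import Relation.Binary.Definitions using (DecidableEquality)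
open import Relation.Binary.PropositionalEquality using (refl; _≢_; ≢-sym)
open import Relation.Nullary using (¬_; yes; no)

module _ {A : Set} where

  Unique-++-∷⁻ : ∀ (xs : List A) {c ys} → Unique (xs ++ c ∷ ys) → Unique (c ∷ xs)
  Unique-++-∷⁻ []       _           = [] ∷ []
  Unique-++-∷⁻ (x ∷ xs) (x∉ ∷ xs!) with Unique-++-∷⁻ xs xs!
  ... | c∉xs ∷ xs!′ = (≢-sym (All.head (++⁻ʳ xs x∉)) ∷ c∉xs) ∷ (++⁻ˡ xs x∉ ∷ xs!′)

  Linked-prefix : ∀ {R : A → A → Set} (xs : List A) {y ys} →
    Linked R (xs ++ y ∷ ys) → Linked R (xs ++ [ y ])
  Linked-prefix []            _        = [-]
  Linked-prefix (x ∷ [])      (r ∷ _)  = r ∷ [-]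
  Linked-prefix (x ∷ x′ ∷ xs) (r ∷ rs) = r ∷ Linked-prefix (x′ ∷ xs) rs

module _ {A : Set} (_≟ᴬ_ : DecidableEquality A) (R : A → A → Set) where

  open import Data.List.Membership.DecPropositional _≟ᴬ_ using (_∈?_)

  Cycle≥2 : Set
  Cycle≥2 = Σ A λ i → Σ (List A) λ rest →
      (1 ≤ length rest)
    × Unique (i ∷ rest)
    × Linked R (i ∷ rest ++ [ i ])

  repetition⇒cycle : ∀ c ys {zs} →
    Linked R (c ∷ ys ++ c ∷ zs) → Linked _≢_ (c ∷ ys ++ c ∷ zs) →
    Unique (ys ++ c ∷ zs) → Cycle≥2
  repetition⇒cycle c []        _     (c≢c ∷ _) _   = ⊥-elim (c≢c refl)
  repetition⇒cycle c (y ∷ ys) Rwalk _         ys! =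
    c , y ∷ ys , s≤s z≤n , Unique-++-∷⁻ (y ∷ ys) ys! , Linked-prefix (c ∷ y ∷ ys) Rwalk

  unique⊎cycle : ∀ xs → Linked R xs → Linked _≢_ xs → Unique xs ⊎ Cycle≥2
  unique⊎cycle []       _     _     = inj₁ []
  unique⊎cycle (c ∷ xs) Rwalk ≢walk
    with unique⊎cycle xs (Linked.tail Rwalk) (Linked.tail ≢walk)
  ... | inj₂ cycle = inj₂ cycle
  ... | inj₁ xs! with c ∈? xs
  ...   | no  c∉xs = inj₁ (¬Any⇒All¬ xs c∉xs ∷ xs!)
  ...   | yes c∈xs with ys , zs , refl ← ∈-∃++ c∈xs =
    inj₂ (repetition⇒cycle c ys Rwalk ≢walk xs!)

module _ {n m : ℕ} (D : ColoredDigraph n m) where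

  open import Data.List.Membership.DecPropositional (_≟_ {n}) using (_∈?_)

  walkLength : ∀ {x y} → Walk D x y → ℕ
  walkLength []          = 0
  walkLength (arc _ _ p) = suc (walkLength p)

  _++ᵂ_ : ∀ {x y z} → Walk D x y → Walk D y z → Walk D x z
  []          ++ᵂ q = q
  arc c e p   ++ᵂ q = arc c e (p ++ᵂ q)

  All-vertices⇒start : ∀ {P : Fin n → Set} {x y} (p : Walk D x y) → All P (vertices D p) → P x
  All-vertices⇒start []          (Px ∷ _) = Px
  All-vertices⇒start (arc _ _ _) (Px ∷ _) = Px

  colors-linked : ∀ {x y} (p : Walk D x y) → Linked (CCArc D) (colors D p)
  colors-linked []                        = []
  colors-linked (arc c e [])              = [-]
  colors-linked {x} (arc c e (arc d e′ q)) = (x , _ , _ , e , e′) ∷ colors-linked (arc d e′ q)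

  dropTo : ∀ {x y a} (p : Walk D x y) → a ∈ vertices D p →
    Σ (Walk D a y) λ q → walkLength q ≤ walkLength p
  dropTo []          (here refl) = [] , ≤-refl
  dropTo (arc c e p) (here refl) = arc c e p , ≤-refl
  dropTo (arc c e p) (there a∈p) with dropTo p a∈p
  ... | q , q≤p = q , ≤-trans q≤p (n≤1+n _)

  module _ (transitive : AllClassesTransitive D) where

    IsProperPath : ∀ {x y} → Walk D x y → Set
    IsProperPath p = IsPath D p × ProperlyColored D p

    Shorter : ∀ {x y} → Walk D x y → Set
    Shorter {x} {y} p = Σ (Walk D x y) λ q → walkLength q < walkLength p

    arc∷properPath⊎shorter : ∀ {x y z} (c : Fin m) (e : ArcOf D x y c) (p : Walk D y z) →
      IsProperPath p → All (x ≢_) (vertices D p) →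
      IsProperPath (arc c e p) ⊎ Shorter (arc c e p)
    arc∷properPath⊎shorter c e [] (p! , _) x∉p = inj₁ (x∉p ∷ p! , [-])
    arc∷properPath⊎shorter {x} {y} c e (arc d e′ q) (p! , proper) x∉p@(_ ∷ x∉q) with c ≟ d
    ... | yes refl = inj₂ (arc c (transitive c x y _ (All-vertices⇒start q x∉q) e e′) q , n<1+n _)
    ... | no  c≢d  = inj₁ (x∉p ∷ p! , c≢d ∷ proper)

    properPath⊎shorter : ∀ {x y} (p : Walk D x y) → IsProperPath p ⊎ Shorter p
    properPath⊎shorter [] = inj₁ ([] ∷ [] , [])
    properPath⊎shorter {x} (arc c e p) with properPath⊎shorter p
    ... | inj₂ (q , q<p) = inj₂ (arc c e q , s≤s q<p)
    ... | inj₁ p-proper with x ∈? vertices D p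
    ...   | yes x∈p = let q , q≤p = dropTo p x∈p in inj₂ (q , s≤s q≤p)
    ...   | no  x∉p = arc∷properPath⊎shorter c e p p-proper (¬Any⇒All¬ _ x∉p)

    properPath : ∀ {x y} (p : Walk D x y) → Σ (Walk D x y) IsProperPath
    properPath p = shorten p (<-wellFounded (walkLength p))
      where
      shorten : ∀ {x y} (p : Walk D x y) → Acc _<_ (walkLength p) → Σ (Walk D x y) IsProperPath
      shorten p (acc shorter-accessible) with properPath⊎shorter p
      ... | inj₁ p-proper = p , p-proper
      ... | inj₂ (q , q<p) = shorten q (shorter-accessible q<p)

  properlyColored⇒rainbow : ¬ CCCycle≥2 D →
    ∀ {x y} (P : Walk D x y) → ProperlyColored D P → Rainbow D P
  properlyColored⇒rainbow acyclic P proper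
    with unique⊎cycle _≟_ (CCArc D) (colors D P) (colors-linked P) proper
  ... | inj₁ rainbow = rainbow
  ... | inj₂ cycle   = ⊥-elim (acyclic cycle)

mainTheorem12 : (n m : ℕ) (D : ColoredDigraph n m) → AllClassesTransitive D →
    (u v w : Fin n) → u ≢ v → v ≢ w → u ≢ w →
    (P₁ : Walk D u v) → IsPath D P₁ →
    (P₂ : Walk D v w) → IsPath D P₂ →
      ((ProperlyColored D P₁ → ProperlyColored D P₂ →
          Σ (Walk D u w) λ P → IsPath D P × ProperlyColored D P)
      × (¬ CCCycle≥2 D →
          ∀ {x y} (P : Walk D x y) → IsPath D P → ProperlyColored D P → Rainbow D P))
mainTheorem12 n m D transitive u v w _ _ _ P₁ _ P₂ _ =
    (λ _ _ → properPath D transitive (_++ᵂ_ D P₁ P₂))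
  , (λ acyclic P _ → properlyColored⇒rainbow D acyclic P)
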